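{- For every $*$-term $P$, $\mathrm{fe}(P)$ can be decomposed as $X[\Box\mapsto Y]$ with $X \in \mathcal{T}_{\Box}$ and $Y \in \mathcal{T}$ such that $X$ contains $\Box$ (possibly $X = \Box$) and $Y = \mathrm{fe}(Q)$ for some $\ell$-term $Q$.
   Context: Let $A$ be a countable set of atoms. FEL-terms: $P ::= a \ (a\in A) \mid \mathsf{T} \mid \mathsf{F} \mid \neg P \mid (P \wedge^{\bullet} P) \mid (P \vee^{\bullet} P)$ (full left-sequential connectives). Subgrammars ($a\in A$): $\mathsf{T}$-terms $P^{\mathsf{T}} ::= \mathsf{T} \mid a \vee^{\bullet} P^{\mathsf{T}}$; $\ell$-terms $P^{\ell} ::= a \wedge^{\bullet} P^{\mathsf{T}} \mid \neg a \wedge^{\bullet} P^{\mathsf{T}}$; $*$-terms $P^* ::= P^c \mid P^d$, $P^c ::= P^{\ell} \mid P^* \wedge^{\bullet} P^d$, $P^d ::= P^{\ell} \mid P^* \vee^{\bullet} P^c$. $\mathcal{T}$ is the set of finite binary trees with leaves in $\{\mathsf{T},\mathsf{F}\}$: $\mathsf{T},\mathsf{F}\in\mathcal{T}$, $(X \trianglelefteq a \trianglerighteq Y)\in\mathcal{T}$ for $X,Y\in\mathcal{T}$, $a\in A$; $\mathcal{T}_{\Box}$ is the analogous set with leaves in $\{\mathsf{T},\mathsf{F},\Box\}$. Leaf replacement $X[\ell_1\mapsto Y_1,\ell_2\mapsto Y_2]$ replaces every leaf $\ell_i$ by $Y_i$, other leaves unchanged. $\mathrm{fe}$: $\mathrm{fe}(\mathsf{T})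 = \mathsf{T}$, $\mathrm{fe}(\mathsf{F}) = \mathsf{F}$, $\mathrm{fe}(a) = \mathsf{T} \trianglelefteq a \trianglerighteq \mathsf{F}$, $\mathrm{fe}(\neg P) = \mathrm{fe}(P)[\mathsf{T}\mapsto\mathsf{F}, \mathsf{F}\mapsto\mathsf{T}]$, $\mathrm{fe}(P \wedge^{\bullet} Q) = \mathrm{fe}(P)[\mathsf{T}\mapsto \mathrm{fe}(Q), \mathsf{F}\mapsto \mathrm{fe}(Q)[\mathsf{T}\mapsto\mathsf{F}]]$, $\mathrm{fe}(P \vee^{\bullet} Q) = \mathrm{fe}(P)[\mathsf{T}\mapsto \mathrm{fe}(Q)[\mathsf{F}\mapsto\mathsf{T}], \mathsf{F}\mapsto \mathrm{fe}(Q)]$. -}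

module Defs where

open import Data.Nat using (ℕ)
open import Relation.Binary.PropositionalEquality using (_≡_)

Atom : Set
Atom = ℕ

data FEL : Set where
  at   : Atom → FEL
  `T   : FEL
  `F   : FEL
  ¬'_  : FEL → FEL
  _∧●_ : FEL → FEL → FEL
  _∨●_ : FEL → FEL → FEL

data IsTTerm : FEL → Set where
  tT  : IsTTerm `T
  tOr : ∀ a {P} → IsTTerm P → IsTTerm (at a ∨● P)

data IsLTerm : FEL → Set where
  lPos : ∀ a {P} → IsTTerm P → IsLTerm (at a ∧● P)
  lNeg : ∀ a {P} → IsTTerm P → IsLTerm ((¬' at a) ∧● P)

data IsStar : FEL → Set
data IsC : FEL → Set
data IsD : FEL → Set

data IsStar where
  sC : ∀ {P} → IsC P → IsStar P
  sD : ∀ {P} → IsD P → IsStar P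

data IsC where
  cL   : ∀ {P} → IsLTerm P → IsC P
  cAnd : ∀ {P Q} → IsStar P → IsD Q → IsC (P ∧● Q)

data IsD where
  dL  : ∀ {P} → IsLTerm P → IsD P
  dOr : ∀ {P Q} → IsStar P → IsC Q → IsD (P ∨● Q)

data Tree : Set where
  T F : Tree
  _◁_▷_ : Tree → Atom → Tree → Tree

data BTree : Set where
  T F □ : BTree
  _◁_▷_ : BTree → Atom → BTree → BTree

replTF : Tree → Tree → Tree → Tree
replTF T y₁ y₂ = y₁
replTF F y₁ y₂ = y₂
replTF (x ◁ a ▷ x') y₁ y₂ = replTF x y₁ y₂ ◁ a ▷ replTF x' y₁ y₂

repl□ : BTree → Tree → Tree
repl□ T y = T
repl□ F y = F
repl□ □ y = y
repl□ (x ◁ a ▷ x') y = repl□ x y ◁ a ▷ repl□ x' y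

data Contains□ : BTree → Set where
  here  : Contains□ □
  left  : ∀ {x a x'} → Contains□ x → Contains□ (x ◁ a ▷ x')
  right : ∀ {x a x'} → Contains□ x' → Contains□ (x ◁ a ▷ x')

fe : FEL → Tree
fe (at a) = T ◁ a ▷ F
fe `T = T
fe `F = F
fe (¬' P) = replTF (fe P) F T
fe (P ∧● Q) = replTF (fe P) (fe Q) (replTF (fe Q) F F)
fe (P ∨● Q) = replTF (fe P) (replTF (fe Q) T T) (fe Q)

module Submission where

-- Two general facts drive
-- the proof.
--  (1) Plugging: if t ∈ 𝒯 has a T-leaf and y₁ is decomposable, then so is
--      t[T ↦ y₁, F ↦ y₂]: lift t to a context in 𝒯_□ by substituting the
--      context of y₁ for T and the (□-free) tree y₂ for F; the T-leaf of t
--      guarantees that □ survives.  Symmetrically with the roles of T and F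
--      exchanged.
--  (2) Leaves: the full evaluation of every *-term has both a T-leaf and an
--      F-leaf (by induction, starting from T-terms and ℓ-terms).
-- Then, by induction on the grammar: an ℓ-term is decomposable with X = □;
-- fe(P ∧● Q) places fe(Q) at the T-leaves of fe(P), so (1) with (2) lifts the
-- decomposition of the disjunctive term Q; dually fe(P ∨● Q) places fe(Q) at
-- the F-leaves of fe(P).

open import Defs
open import Data.Product using (Σ; _×_; _,_; proj₁; proj₂)
open import Relation.Binary.PropositionalEquality using (_≡_; refl; cong; cong₂; sym)
open Relation.Binary.PropositionalEquality.≡-Reasoning

data Has (l : Tree) : Tree → Set where
  here  : Has l l
  left  : ∀ {x a x'} → Has l x  → Has l (x ◁ a ▷ x')
  right : ∀ {x a x'} → Has l x' → Has l (x ◁ a ▷ x')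

has-replTF-T : ∀ {l t y₁ y₂} → Has T t → Has l y₁ → Has l (replTF t y₁ y₂)
has-replTF-T here      h = h
has-replTF-T (left p)  h = left  (has-replTF-T p h)
has-replTF-T (right p) h = right (has-replTF-T p h)

has-replTF-F : ∀ {l t y₁ y₂} → Has F t → Has l y₂ → Has l (replTF t y₁ y₂)
has-replTF-F here      h = h
has-replTF-F (left p)  h = left  (has-replTF-F p h)
has-replTF-F (right p) h = right (has-replTF-F p h)

embed : Tree → BTree
embed T = T
embed F = F
embed (x ◁ a ▷ x') = embed x ◁ a ▷ embed x'

repl□-embed : ∀ t y → repl□ (embed t) y ≡ t
repl□-embed T y = refl
repl□-embed F y = refl
repl□-embed (t ◁ a ▷ t') y = cong₂ (_◁ a ▷_) (repl□-embed t y) (repl□-embed t' y)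

replTF□ : Tree → BTree → BTree → BTree
replTF□ T x₁ x₂ = x₁
replTF□ F x₁ x₂ = x₂
replTF□ (t ◁ a ▷ t') x₁ x₂ = replTF□ t x₁ x₂ ◁ a ▷ replTF□ t' x₁ x₂

repl□-replTF□ : ∀ t x₁ x₂ y →
  repl□ (replTF□ t x₁ x₂) y ≡ replTF t (repl□ x₁ y) (repl□ x₂ y)
repl□-replTF□ T x₁ x₂ y = refl
repl□-replTF□ F x₁ x₂ y = refl
repl□-replTF□ (t ◁ a ▷ t') x₁ x₂ y =
  cong₂ (_◁ a ▷_) (repl□-replTF□ t x₁ x₂ y) (repl□-replTF□ t' x₁ x₂ y)

contains□-replTF□-T : ∀ {t x₁ x₂} → Has T t → Contains□ x₁ → Contains□ (replTF□ t x₁ x₂)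
contains□-replTF□-T here      c = c
contains□-replTF□-T (left p)  c = left  (contains□-replTF□-T p c)
contains□-replTF□-T (right p) c = right (contains□-replTF□-T p c)

contains□-replTF□-F : ∀ {t x₁ x₂} → Has F t → Contains□ x₂ → Contains□ (replTF□ t x₁ x₂)
contains□-replTF□-F here      c = c
contains□-replTF□-F (left p)  c = left  (contains□-replTF□-F p c)
contains□-replTF□-F (right p) c = right (contains□-replTF□-F p c)

Decomposable : Tree → Set
Decomposable y = Σ BTree λ X → Σ FEL λ Q →
  Contains□ X × IsLTerm Q × y ≡ repl□ X (fe Q)

ℓ-decomposable : ∀ {Q} → IsLTerm Q → Decomposable (fe Q)
ℓ-decomposable {Q} ℓ = □ , Q , here , ℓ , refl

decomposable-at-T : ∀ {t y₁} y₂ → Has T t → Decomposable y₁ →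
  Decomposable (replTF t y₁ y₂)
decomposable-at-T {t} {y₁} y₂ hasT (X , Q , c , ℓ , y₁≡) =
  replTF□ t X (embed y₂) , Q , contains□-replTF□-T hasT c , ℓ , eq
  where
  eq : replTF t y₁ y₂ ≡ repl□ (replTF□ t X (embed y₂)) (fe Q)
  eq = begin
    replTF t y₁ y₂
      ≡⟨ cong₂ (replTF t) y₁≡ (sym (repl□-embed y₂ (fe Q))) ⟩
    replTF t (repl□ X (fe Q)) (repl□ (embed y₂) (fe Q))
      ≡⟨ sym (repl□-replTF□ t X (embed y₂) (fe Q)) ⟩
    repl□ (replTF□ t X (embed y₂)) (fe Q) ∎

decomposable-at-F : ∀ {t y₂} y₁ → Has F t → Decomposable y₂ →
  Decomposable (replTF t y₁ y₂)
decomposable-at-F {t} {y₂} y₁ hasF (X , Q , c , ℓ , y₂≡) =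
  replTF□ t (embed y₁) X , Q , contains□-replTF□-F hasF c , ℓ , eq
  where
  eq : replTF t y₁ y₂ ≡ repl□ (replTF□ t (embed y₁) X) (fe Q)
  eq = begin
    replTF t y₁ y₂
      ≡⟨ cong₂ (replTF t) (sym (repl□-embed y₁ (fe Q))) y₂≡ ⟩
    replTF t (repl□ (embed y₁) (fe Q)) (repl□ X (fe Q))
      ≡⟨ sym (repl□-replTF□ t (embed y₁) X (fe Q)) ⟩
    repl□ (replTF□ t (embed y₁) X) (fe Q) ∎

HasTF : Tree → Set
HasTF t = Has T t × Has F t

T-term-has-T : ∀ {P} → IsTTerm P → Has T (fe P)
T-term-has-T tT         = here
T-term-has-T (tOr a p)  = right (T-term-has-T p)

-- fe(a ∧● P) = fe(P) ◁ a ▷ fe(P)[T,F ↦ F] (branches swapped for ¬a): the T-leaf of fe(P)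
-- gives a T-leaf on one side and, after replacement, an F-leaf on the other.
ℓ-term-hasTF : ∀ {P} → IsLTerm P → HasTF (fe P)
ℓ-term-hasTF (lPos a p) = left  (T-term-has-T p) , right (has-replTF-T (T-term-has-T p) here)
ℓ-term-hasTF (lNeg a p) = right (T-term-has-T p) , left  (has-replTF-T (T-term-has-T p) here)

star-hasTF : ∀ {P} → IsStar P → HasTF (fe P)
conj-hasTF : ∀ {P} → IsC P → HasTF (fe P)
disj-hasTF : ∀ {P} → IsD P → HasTF (fe P)

star-hasTF (sC c) = conj-hasTF c
star-hasTF (sD d) = disj-hasTF d

conj-hasTF (cL ℓ) = ℓ-term-hasTF ℓ
conj-hasTF (cAnd p q) =
  let (hasT-P , _) = star-hasTF p
      (hasT-Q , hasF-Q) = disj-hasTF q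
  in has-replTF-T hasT-P hasT-Q , has-replTF-T hasT-P hasF-Q

disj-hasTF (dL ℓ) = ℓ-term-hasTF ℓ
disj-hasTF (dOr p q) =
  let (_ , hasF-P) = star-hasTF p
      (hasT-Q , hasF-Q) = conj-hasTF q
  in has-replTF-F hasF-P hasT-Q , has-replTF-F hasF-P hasF-Q

conj-decomposable : ∀ {P} → IsC P → Decomposable (fe P)
disj-decomposable : ∀ {P} → IsD P → Decomposable (fe P)

conj-decomposable (cL ℓ) = ℓ-decomposable ℓ
conj-decomposable {P ∧● Q} (cAnd p q) =
  decomposable-at-T (replTF (fe Q) F F) (proj₁ (star-hasTF p)) (disj-decomposable q)

disj-decomposable (dL ℓ) = ℓ-decomposable ℓ
disj-decomposable {P ∨● Q} (dOr p q) =
  decomposable-at-F (replTF (fe Q) T T) (proj₂ (star-hasTF p)) (conj-decomposable q)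

mainTheorem14 : (P : FEL) → IsStar P →
    Σ BTree λ X → Σ FEL λ Q →
      Contains□ X × IsLTerm Q × fe P ≡ repl□ X (fe Q)
mainTheorem14 P (sC c) = conj-decomposable c
mainTheorem14 P (sD d) = disj-decomposable d
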